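{- Let $H$ be an irreflexive square-free graph and let $G$ be a connected irreflexive bipartite graph with at least one edge and bipartition $V(G)=G_0\sqcup G_1$. Let $V(H\times K_2)=H_0\sqcup H_1$ be a bipartition of $H\times K_2$. Let $\alpha,\beta:G\to H\times K_2$ be homomorphisms that map the vertices of $G_0$ into the same part ($H_0$ or $H_1$) of $H\times K_2$. Then there is a path from $\alpha$ to $\beta$ in $\mathrm{Col}(G,H\times K_2)$ if and only if there is a path from $\alpha$ to $\beta$ in $\mathrm{Col}(G,(H\times K_2)^\circ)$.
   Context: Graphs are finite, undirected, without parallel edges, possibly with loops. Irreflexive means no loops; $X^\circ$ denotes $X$ with a loop added at every vertex. Square-free means containing no 4-cycle as a subgraph. The categorical product $A\times B$ has vertex set $V(A)\times V(B)$, with $(a,b)\sim(a',b')$ iff $aa'\in E(A)$ and $bb'\in E(B)$; $K_2$ is the single edge, so $H\times K_2$ is bipartite. A homomorphism $\alpha:G\to X$ is a map with $\alpha(u)\alpha(v)\in E(X)$ for all $uv\in E(G)$. $\mathrm{Hom}(G,X)$ has homomorphisms as vertices, $\alpha\beta$ an edge if $\alpha(u)\beta(v)\in E(X)$ for every edge $uv$ of $G$; $\mathrm{Col}(G,X)$ is its spanning subgraph keeping only edges between homomorphisms differing on at most one vertex. -}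

module Defs where

open import Data.Nat using (ℕ)
open import Data.Fin using (Fin)
open import Data.Bool using (Bool; true; false)
open import Data.Product using (Σ; ∃; _×_; _,_; proj₁; proj₂)
open import Data.Sum using (_⊎_; inj₁; inj₂)
open import Relation.Nullary using (¬_)
open import Relation.Binary using (Decidable)
open import Relation.Binary.PropositionalEquality using (_≡_; _≢_; refl; sym)
open import Relation.Binary.Construct.Closure.ReflexiveTransitive using (Star)
open import Function.Bundles using (_↔_)

record Graph : Set₁ where
  field
    V    : Set
    E    : V → V → Set
    Esym : ∀ {u v} → E u v → E v u
open Graph public

record Finite (G : Graph) : Set where
  field
    size : ℕ
    enum : V G ↔ Fin size
    dec  : Decidable (E G)

Irreflexive : Graph → Set
Irreflexive G = ∀ v → ¬ E G v v

SquareFree : Graph → Set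
SquareFree G = ∀ (a b c d : V G) →
  a ≢ b → a ≢ c → a ≢ d → b ≢ c → b ≢ d → c ≢ d →
  ¬ (E G a b × E G b c × E G c d × E G d a)

Connected : Graph → Set
Connected G = ∀ (u v : V G) → Star (E G) u v

HasEdge : Graph → Set
HasEdge G = Σ (V G) λ u → Σ (V G) λ v → E G u v

-- A bipartition: side false = part 0, side true = part 1; every edge crosses.
record Bipartition (G : Graph) : Set where
  field
    side  : V G → Bool
    cross : ∀ {u v} → E G u v → side u ≢ side v
open Bipartition public

K₂ : Graph
K₂ = record { V = Bool ; E = λ a b → a ≢ b ; Esym = λ p q → p (sym q) }

_⊗_ : Graph → Graph → Graph
A ⊗ B = record
  { V = V A × V B
  ; E = λ x y → E A (proj₁ x) (proj₁ y) × E B (proj₂ x) (proj₂ y)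
  ; Esym = λ { (p , q) → Esym A p , Esym B q } }

_° : Graph → Graph
X ° = record
  { V = V X
  ; E = λ x y → (x ≡ y) ⊎ E X x y
  ; Esym = λ { (inj₁ p) → inj₁ (sym p) ; (inj₂ q) → inj₂ (Esym X q) } }

record Hom (G X : Graph) : Set where
  constructor hom
  field
    map      : V G → V X
    preserve : ∀ {u v} → E G u v → E X (map u) (map v)
open Hom public

toLooped : ∀ {G X} → Hom G X → Hom G (X °)
toLooped α = hom (map α) (λ e → inj₂ (preserve α e))

HomEdge : (G X : Graph) → Hom G X → Hom G X → Set
HomEdge G X α β = ∀ {u v} → E G u v → E X (map α u) (map β v)

ColEdge : (G X : Graph) → Hom G X → Hom G X → Set
ColEdge G X α β =
  HomEdge G X α β × Σ (V G) λ w → ∀ u → u ≢ w → map α u ≡ map β u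

ColPath : (G X : Graph) → Hom G X → Hom G X → Set
ColPath G X = Star (ColEdge G X)

SamePart : ∀ {G X} → Bipartition G → Bipartition X → Hom G X → Hom G X → Set
SamePart {G} c d α β = Σ Bool λ p →
  ∀ v → side c v ≡ false → (side d (map α v) ≡ p) × (side d (map β v) ≡ p)

{-# OPTIONS --safe #-}
-- Write X = H × K₂ and call the K₂-coordinate of a vertex its parity. Along a
-- walk α = f₀, f₁, …, fₙ = β in Col(G, X°) we carry a genuine homomorphism
-- φᵢ : G → X, reachable from α in Col(G, X), with φᵢ(v) equal or adjacent to
-- fᵢ(v) for every v. When fᵢ changes at w, φᵢ is recoloured at w alone: to
-- fᵢ₊₁(w) if that has the parity of φᵢ(w); otherwise to φᵢ(w) itself if it is
-- adjacent to fᵢ₊₁(w); otherwise to fᵢ(u₀) for a neighbour u₀ of w, which works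
-- because square-freeness of H collapses each closed walk
-- φᵢ(u) fᵢ(u) fᵢ(w) φᵢ(w). The side in the given bipartition of X xor the parity
-- is constant on the components of X°, so the same-part hypothesis forces β to
-- have the parities of α, hence of φₙ; then φₙ and β, being equal or adjacent
-- everywhere, are equal.
module Submission where

open import Defs
open import Data.Bool using (Bool; true; false; not; _xor_)
open import Data.Bool.Properties using (¬-not; not-injective; xor-annihilates-not)
  renaming (_≟_ to _≟ᵇ_)
import Data.Fin.Properties as Fin
open import Data.Empty using (⊥; ⊥-elim)
open import Data.Product using (∃; _×_; _,_; proj₁; proj₂)
open import Data.Sum using (inj₁; inj₂)
open import Function.Bundles using (_⇔_; mk⇔)
open import Function.Properties.Inverse using (↔⇒↣)
open import Relation.Binary.Definitions using (Decidable; DecidableEquality)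
open import Relation.Binary.PropositionalEquality
open import Relation.Binary.Construct.Closure.ReflexiveTransitive
  using (Star; ε; _◅_; _◅◅_; gmap)
open import Relation.Nullary using (¬_; yes; no)
open import Relation.Nullary.Decidable using (via-injection; decidable-stable)

≢-≢⇒≡ : ∀ {a b c : Bool} → a ≢ b → b ≢ c → a ≡ c
≢-≢⇒≡ a≢b b≢c = trans (¬-not a≢b) (sym (¬-not (≢-sym b≢c)))

xor-cancelˡ : ∀ a {b c} → a xor b ≡ a xor c → b ≡ c
xor-cancelˡ false eq = eq
xor-cancelˡ true  eq = not-injective eq

finite⇒decEq : ∀ {G} → Finite G → DecidableEquality (V G)
finite⇒decEq F = via-injection (↔⇒↣ (Finite.enum F)) Fin._≟_

adjacent⇒≢ : ∀ {B} → Irreflexive B → ∀ {x y} → E B x y → x ≢ y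
adjacent⇒≢ irr xy refl = irr _ xy

squareFree⇒4-walk-degenerate : ∀ {B} → Irreflexive B → SquareFree B →
  ∀ {a b c d} → E B a b → E B b c → E B c d → E B d a → b ≢ d → a ≢ c → ⊥
squareFree⇒4-walk-degenerate {B} irr sq ab bc cd da b≢d a≢c =
  sq _ _ _ _ (≢ ab) a≢c (≢-sym (≢ da)) (≢ bc) b≢d (≢ cd) (ab , bc , cd , da)
  where
  ≢ : ∀ {x y} → E B x y → x ≢ y
  ≢ = adjacent⇒≢ {B} irr

NoIsolatedVertex : Graph → Set
NoIsolatedVertex G = ∀ w → ∃ λ u → E G u w

connected⇒noIsolatedVertex : ∀ {G} → Connected G → HasEdge G → NoIsolatedVertex G
connected⇒noIsolatedVertex {G} conn (x , y , xy) w with conn w x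
... | ε        = y , Esym G xy
... | wu ◅ _   = _ , Esym G wu

part₀-inhabited : ∀ {G} → HasEdge G → (c : Bipartition G) → ∃ λ v → side c v ≡ false
part₀-inhabited (x , y , xy) c with side c x in x-side
... | false = x , x-side
... | true  = y , trans (¬-not (≢-sym (cross c xy))) (cong not x-side)

colPath⇒colPath° : ∀ {G Y} {φ ψ : Hom G Y} →
                   ColPath G Y φ ψ → ColPath G (Y °) (toLooped φ) (toLooped ψ)
colPath⇒colPath° = gmap toLooped λ { (φ→ψ , w , fixed) → (λ uv → inj₂ (φ→ψ uv)) , w , fixed }

pointwise≡⇒colEdge : ∀ {G Y} {φ ψ : Hom G Y} → V G →
                     (∀ v → map φ v ≡ map ψ v) → ColEdge G Y φ ψ
pointwise≡⇒colEdge {Y = Y} {φ} w φ≡ψ =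
  (λ {u} {v} uv → subst (E Y (map φ u)) (φ≡ψ v) (preserve φ uv)) , w , λ v _ → φ≡ψ v

module Recolour {G Y : Graph} (_≟_ : DecidableEquality (V G)) (irr : Irreflexive G)
                (φ : Hom G Y) (w : V G) (z : V Y)
                (z-adj : ∀ {u} → E G u w → E Y (map φ u) z) where

  recoloured-map : V G → V Y
  recoloured-map v with v ≟ w
  ... | yes _ = z
  ... | no  _ = map φ v

  recoloured-elim : (P : V G → V Y → Set) → P w z → (∀ v → v ≢ w → P v (map φ v)) →
                    ∀ v → P v (recoloured-map v)
  recoloured-elim P at-w off-w v with v ≟ w
  ... | yes refl = at-w
  ... | no  v≢w  = off-w v v≢w

  recoloured : Hom G Y
  recoloured = hom recoloured-map preserves
    where
    preserves : ∀ {u v} → E G u v → E Y (recoloured-map u) (recoloured-map v)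
    preserves {u} {v} uv with u ≟ w | v ≟ w
    ... | yes refl | yes refl = ⊥-elim (irr w uv)
    ... | yes refl | no  _    = Esym Y (z-adj (Esym G uv))
    ... | no  _    | yes refl = z-adj uv
    ... | no  _    | no  _    = preserve φ uv

  recoloured-colEdge : ColEdge G Y φ recoloured
  recoloured-colEdge =
    (λ {u} uv → recoloured-elim (λ v y → E G u v → E Y (map φ u) y)
                                z-adj (λ _ _ → preserve φ) _ uv) ,
    w , λ v → recoloured-elim (λ v y → v ≢ w → map φ v ≡ y)
                              (λ w≢w → ⊥-elim (w≢w refl)) (λ _ _ _ → refl) v

module BipartiteDouble (B : Graph) where

  X : Graph
  X = B ⊗ K₂

  parity : V X → Bool
  parity = proj₂

  °-sameParity⇒≡ : ∀ {x y} → E (X °) x y → parity x ≡ parity y → x ≡ y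
  °-sameParity⇒≡ (inj₁ x≡y)        _    = x≡y
  °-sameParity⇒≡ (inj₂ (_ , flip)) same = ⊥-elim (flip same)

  °-oppositeParity⇒edge : ∀ {x y} → E (X °) x y → parity x ≢ parity y → E X x y
  °-oppositeParity⇒edge (inj₁ refl) opp = ⊥-elim (opp refl)
  °-oppositeParity⇒edge (inj₂ xy)   _   = xy

  °-2walk-oppositeParity⇒edge : ∀ {x y z} → E (X °) x y → E (X °) y z →
                                parity x ≢ parity z → E X x z
  °-2walk-oppositeParity⇒edge (inj₁ refl) yz opp = °-oppositeParity⇒edge yz opp
  °-2walk-oppositeParity⇒edge xy (inj₁ refl) opp = °-oppositeParity⇒edge xy opp
  °-2walk-oppositeParity⇒edge (inj₂ (_ , x≢y)) (inj₂ (_ , y≢z)) opp =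
    ⊥-elim (opp (≢-≢⇒≡ x≢y y≢z))

  module _ {G : Graph} where

    homEdge⇒sameParity : {φ ψ : Hom G X} → HomEdge G X φ ψ →
                         ∀ {u v} → E G u v → parity (map φ u) ≡ parity (map ψ u)
    homEdge⇒sameParity {ψ = ψ} φ→ψ uv =
      ≢-≢⇒≡ (proj₂ (φ→ψ uv)) (≢-sym (proj₂ (preserve ψ uv)))

    colPath⇒sameParity : NoIsolatedVertex G → {φ ψ : Hom G X} → ColPath G X φ ψ →
                         ∀ v → parity (map φ v) ≡ parity (map ψ v)
    colPath⇒sameParity nbr ε                  v = refl
    colPath⇒sameParity nbr {φ} (_◅_ {j = χ} (φ→χ , _) path) v =
      trans (homEdge⇒sameParity {φ} {χ} φ→χ (Esym G (proj₂ (nbr v))))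
            (colPath⇒sameParity nbr path v)

    connected⇒sameParity : Connected G → {φ ψ : Hom G X} →
      ∀ {v₀} → parity (map φ v₀) ≡ parity (map ψ v₀) →
      ∀ v → parity (map φ v) ≡ parity (map ψ v)
    connected⇒sameParity conn {φ} {ψ} {v₀} same v = propagate (conn v₀ v) same
      where
      propagate : ∀ {x y} → Star (E G) x y →
                  parity (map φ x) ≡ parity (map ψ x) → parity (map φ y) ≡ parity (map ψ y)
      propagate ε            same = same
      propagate (xz ◅ path) same = propagate path
        (≢-≢⇒≡ (≢-sym (proj₂ (preserve φ xz)))
               (subst (_≢ parity (map ψ _)) (sym same) (proj₂ (preserve ψ xz))))

  module _ (d : Bipartition X) where

    label : V X → Bool
    label x = side d x xor parity x

    label-°-invariant : ∀ {x y} → E (X °) x y → label x ≡ label y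
    label-°-invariant (inj₁ refl) = refl
    label-°-invariant {x} {y} (inj₂ xy) = begin
      side d x xor parity x                 ≡⟨ xor-annihilates-not (side d x) (parity x) ⟨
      not (side d x) xor not (parity x)     ≡⟨ cong₂ _xor_ (flips (cross d xy)) (flips (proj₂ xy)) ⟨
      side d y xor parity y                 ∎
      where
      open ≡-Reasoning
      flips : ∀ {a b : Bool} → a ≢ b → b ≡ not a
      flips a≢b = ¬-not (≢-sym a≢b)

    module _ {G : Graph} (nbr : NoIsolatedVertex G) where

      colPath°⇒sameLabel : {f g : Hom G (X °)} → ColPath G (X °) f g →
                           ∀ v → label (map f v) ≡ label (map g v)
      colPath°⇒sameLabel ε v = refl
      colPath°⇒sameLabel (_◅_ {j = g} (f→g , _) path) v =
        trans (trans (label-°-invariant (f→g vu)) (sym (label-°-invariant (preserve g vu))))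
              (colPath°⇒sameLabel path v)
        where
        vu : E G v (proj₁ (nbr v))
        vu = Esym G (proj₂ (nbr v))

      colPath°⇒sameSide⇒sameParity :
        {α β : Hom G X} → ColPath G (X °) (toLooped α) (toLooped β) →
        ∀ {v} → side d (map α v) ≡ side d (map β v) → parity (map α v) ≡ parity (map β v)
      colPath°⇒sameSide⇒sameParity {α} {β} path {v} sameSide =
        xor-cancelˡ (side d (map α v)) (begin
          side d (map α v) xor parity (map α v) ≡⟨ colPath°⇒sameLabel path v ⟩
          side d (map β v) xor parity (map β v) ≡⟨ cong (_xor parity (map β v)) sameSide ⟨
          side d (map α v) xor parity (map β v) ∎)
        where open ≡-Reasoning

  module Shadowing {G : Graph} (_≟_ : DecidableEquality (V G)) (irrG : Irreflexive G)
                   (nbr : NoIsolatedVertex G) (irrB : Irreflexive B) (sqB : SquareFree B)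
                   (adj? : Decidable (E B)) where

    record Shadows (φ : Hom G X) (f : Hom G (X °)) : Set where
      constructor shadows
      field near : ∀ v → E (X °) (map φ v) (map f v)
    open Shadows

    ShadowColour : Hom G X → V G → V X → Set
    ShadowColour φ w y = ∃ λ z → E (X °) z y × (∀ {u} → E G u w → E X (map φ u) z)

    square-shadowColour : {φ : Hom G X} {f f' : Hom G (X °)} →
      Shadows φ f → HomEdge G (X °) f f' → ∀ {w} →
      parity (map f' w) ≢ parity (map φ w) → ¬ E B (proj₁ (map φ w)) (proj₁ (map f' w)) →
      ∀ {u₀} → E G u₀ w → ∀ {u} → E G u w → E X (map φ u) (map f u₀)
    square-shadowColour {φ} {f} {f'} φ~f f→f' {w} f'w≢p φw≁f'w {u₀} u₀w {u} uw =
      φu~fu₀ , λ same → φ-flips uw (trans same (neighbour-parity u₀w))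
      where
      p : Bool
      p = parity (map φ w)

      φ-flips : ∀ {v} → E G v w → parity (map φ v) ≢ p
      φ-flips vw = proj₂ (preserve φ vw)

      fw≢p : parity (map f w) ≢ p
      fw≢p same = φw≁f'w (proj₁ (subst (λ t → E X t (map f' w)) (sym φw≡fw) fw~f'w))
        where
        φw≡fw : map φ w ≡ map f w
        φw≡fw = °-sameParity⇒≡ (near φ~f w) (sym same)
        fw~f'w : E X (map f w) (map f' w)
        fw~f'w = °-2walk-oppositeParity⇒edge (Esym (X °) (preserve f u₀w)) (f→f' u₀w)
                                              (λ same' → f'w≢p (trans (sym same') same))

      neighbour-parity : ∀ {v} → E G v w → parity (map f v) ≡ p
      neighbour-parity {v} vw = ≢-≢⇒≡ fv≢φv (φ-flips vw)
        where
        fv≢φv : parity (map f v) ≢ parity (map φ v)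
        fv≢φv same = φw≁f'w (proj₁ (subst (E X (map φ w)) φv≡f'w (preserve φ (Esym G vw))))
          where
          φv≡f'w : map φ v ≡ map f' w
          φv≡f'w = trans (°-sameParity⇒≡ (near φ~f v) (sym same))
                         (°-sameParity⇒≡ (f→f' vw)
                            (≢-≢⇒≡ (λ q → φ-flips vw (trans (sym same) q)) (≢-sym f'w≢p)))

      fv~fw : ∀ {v} → E G v w → E X (map f v) (map f w)
      fv~fw vw = °-oppositeParity⇒edge (preserve f vw)
                                       (λ same → fw≢p (trans (sym same) (neighbour-parity vw)))

      -- φ(u) f(u) f(w) φ(w) is a closed walk in B whose diagonal f(u), φ(w) is
      -- proper (f(u) is adjacent to f'(w), φ(w) is not), so φ(u) = f(w) in B.
      φu~fu₀ : E B (proj₁ (map φ u)) (proj₁ (map f u₀))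
      φu~fu₀ = decidable-stable (adj? _ _) λ φu≁fu₀ →
        squareFree⇒4-walk-degenerate {B} irrB sqB
          (proj₁ (°-oppositeParity⇒edge (near φ~f u)
                    (λ same → φ-flips uw (trans same (neighbour-parity uw)))))
          (proj₁ (fv~fw uw))
          (proj₁ (Esym X (°-oppositeParity⇒edge (near φ~f w) (≢-sym fw≢p))))
          (proj₁ (preserve φ (Esym G uw)))
          (λ fu≡φw → φw≁f'w (subst (λ t → E B t _) fu≡φw (proj₁ fu~f'w)))
          (λ φu≡fw → φu≁fu₀ (subst (λ t → E B t _) (sym φu≡fw) (proj₁ (Esym X (fv~fw u₀w)))))
        where
        fu~f'w : E X (map f u) (map f' w)
        fu~f'w = °-oppositeParity⇒edge (f→f' uw)
                                       (λ same → f'w≢p (trans (sym same) (neighbour-parity uw)))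

    shadowColour : {φ : Hom G X} {f f' : Hom G (X °)} →
                   Shadows φ f → HomEdge G (X °) f f' → ∀ w → ShadowColour φ w (map f' w)
    shadowColour {φ} {f} {f'} φ~f f→f' w
      with parity (map f' w) ≟ᵇ parity (map φ w) | adj? (proj₁ (map φ w)) (proj₁ (map f' w))
    ... | yes same | _ = map f' w , inj₁ refl , λ uw →
      °-2walk-oppositeParity⇒edge (near φ~f _) (f→f' uw) (λ q → proj₂ (preserve φ uw) (trans q same))
    ... | no f'w≢p | yes φw~f'w = map φ w , inj₂ (φw~f'w , ≢-sym f'w≢p) , preserve φ
    ... | no f'w≢p | no  φw≁f'w =
      map f u₀ , f→f' u₀w , square-shadowColour {f' = f'} φ~f f→f' f'w≢p φw≁f'w u₀w
      where
      u₀ : V G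
      u₀ = proj₁ (nbr w)
      u₀w : E G u₀ w
      u₀w = proj₂ (nbr w)

    shadow-step : {φ : Hom G X} {f f' : Hom G (X °)} → Shadows φ f → ColEdge G (X °) f f' →
                  ∃ λ φ' → ColEdge G X φ φ' × Shadows φ' f'
    shadow-step {φ} {f} {f'} φ~f (f→f' , w , fixed) with shadowColour {f' = f'} φ~f f→f' w
    ... | z , z~f'w , z-adj =
      recoloured , recoloured-colEdge ,
      shadows (recoloured-elim (λ v y → E (X °) y (map f' v)) z~f'w
                 (λ v v≢w → subst (E (X °) (map φ v)) (fixed v v≢w) (near φ~f v)))
      where open Recolour _≟_ irrG φ w z z-adj

    shadow-colPath : {φ : Hom G X} {f g : Hom G (X °)} → Shadows φ f → ColPath G (X °) f g →
                     ∃ λ ψ → ColPath G X φ ψ × Shadows ψ g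
    shadow-colPath φ~f ε = _ , ε , φ~f
    shadow-colPath φ~f (step ◅ steps) with shadow-step φ~f step
    ... | φ' , φ→φ' , φ'~f' with shadow-colPath φ'~f' steps
    ... | ψ , φ'→ψ , ψ~g = ψ , φ→φ' ◅ φ'→ψ , ψ~g

    colPath°⇒colPath : {α β : Hom G X} → V G → (∀ v → parity (map α v) ≡ parity (map β v)) →
                       ColPath G (X °) (toLooped α) (toLooped β) → ColPath G X α β
    colPath°⇒colPath {α} {β} w sameParity path with shadow-colPath (shadows λ _ → inj₁ refl) path
    ... | ψ , α→ψ , ψ~β = α→ψ ◅◅ pointwise≡⇒colEdge {G} {X} {ψ} {β} w ψ≡β ◅ ε
      where
      ψ≡β : ∀ v → map ψ v ≡ map β v
      ψ≡β v = °-sameParity⇒≡ (near ψ~β v)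
                (trans (sym (colPath⇒sameParity nbr α→ψ v)) (sameParity v))

lemma13 : (H G : Graph) → Finite H → Finite G →
          Irreflexive H → SquareFree H →
          Irreflexive G → Connected G → HasEdge G →
          (c : Bipartition G) → (d : Bipartition (H ⊗ K₂)) →
          (α β : Hom G (H ⊗ K₂)) → SamePart c d α β →
          ColPath G (H ⊗ K₂) α β ⇔ ColPath G ((H ⊗ K₂) °) (toLooped α) (toLooped β)
lemma13 H G FH FG irrH sqH irrG conG edG c d α β (_ , samePart) =
  mk⇔ colPath⇒colPath°
      (λ path → colPath°⇒colPath v₀ (sameParity path) path)
  where
  open BipartiteDouble H

  nbr : NoIsolatedVertex G
  nbr = connected⇒noIsolatedVertex {G} conG edG

  open Shadowing (finite⇒decEq FG) irrG nbr irrH sqH (Finite.dec FH)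

  v₀ : V G
  v₀ = proj₁ (part₀-inhabited edG c)

  sameSide : side d (map α v₀) ≡ side d (map β v₀)
  sameSide with samePart v₀ (proj₂ (part₀-inhabited edG c))
  ... | α-side , β-side = trans α-side (sym β-side)

  sameParity : ColPath G (X °) (toLooped α) (toLooped β) →
               ∀ v → parity (map α v) ≡ parity (map β v)
  sameParity path =
    connected⇒sameParity {G} conG {α} {β} (colPath°⇒sameSide⇒sameParity d {G} nbr path sameSide)
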